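{- Let $H$ be a graph and let $G$ be an $n$-vertex edge-coloured graph which does not contain a rainbow copy of $H$. Suppose that $G$ has exactly $m$ bad non-edges. Then $\mathrm{rsat}(n,H)\le |E(G)|+m$.
   Context: An edge-coloured graph is a pair $(G,c)$ where $c$ is a (not necessarily proper) colouring of $E(G)$ with colours from $\mathbb{N}$. A subgraph is rainbow if all its edges receive distinct colours. For a colour $c$, a non-edge $e$ of $G$ is $c$-bad for $G$ (with respect to $H$) if adding $e$ to $G$ in colour $c$ does not create a rainbow copy of $H$; a non-edge is bad if it is $c$-bad for some colour $c\in\mathbb{N}$. An edge-coloured graph is $H$-rainbow saturated if it contains no rainbow copy of $H$, but adding any non-edge in any colour from $\mathbb{N}$ creates a rainbow copy of $H$. $\mathrm{rsat}(n,H)$ is the minimum number of edges in an $H$-rainbow saturated edge-coloured graph on $n$ vertices. -}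

module Defs where

open import Data.Nat using (ℕ; _≤_)
open import Data.Fin using (Fin; toℕ; _≟_) renaming (_<_ to _<ᶠ_)
open import Data.Fin.Properties using ()
open import Data.Bool using (Bool; true; false; _∧_; _∨_; if_then_else_)
open import Data.Maybe using (Maybe; just; nothing; is-just)
open import Data.List using (List; length; filterᵇ; cartesianProduct; allFin)
open import Data.Product using (Σ; ∃; _×_; _,_; proj₁; proj₂)
open import Data.Sum using (_⊎_)
open import Relation.Nullary using (¬_; does)
open import Relation.Binary.PropositionalEquality using (_≡_; _≢_)
open import Function.Definitions using (Injective)

record Graph (h : ℕ) : Set where
  field
    adj    : Fin h → Fin h → Bool
    sym    : ∀ u v → adj u v ≡ adj v u
    irrefl : ∀ u → adj u u ≡ false
open Graph public

-- A colour function on Fin n: col i j ≡ just c means ij is an edge of colour c,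
-- col i j ≡ nothing means ij is a non-edge.
Col : ℕ → Set
Col n = Fin n → Fin n → Maybe ℕ

record ECGraph (n : ℕ) : Set where
  field
    col    : Col n
    sym    : ∀ i j → col i j ≡ col j i
    irrefl : ∀ i → col i i ≡ nothing
open ECGraph public

edgeCount : ∀ {n} → ECGraph n → ℕ
edgeCount {n} G =
  length (filterᵇ (λ p → (toℕ (proj₁ p) Data.Nat.<ᵇ toℕ (proj₂ p)) ∧ is-just (col G (proj₁ p) (proj₂ p)))
                  (cartesianProduct (allFin n) (allFin n)))

record RainbowCopy {h n : ℕ} (H : Graph h) (c : Col n) : Set where
  field
    φ      : Fin h → Fin n
    φ-inj  : Injective _≡_ _≡_ φ
    edges  : ∀ u v → adj H u v ≡ true → ∃ λ k → c (φ u) (φ v) ≡ just k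
    rainbow : ∀ u v u' v' k → adj H u v ≡ true → adj H u' v' ≡ true →
              c (φ u) (φ v) ≡ just k → c (φ u') (φ v') ≡ just k →
              (u ≡ u' × v ≡ v') ⊎ (u ≡ v' × v ≡ u')

addEdge : ∀ {n} → Col n → Fin n → Fin n → ℕ → Col n
addEdge c i j k x y =
  if (does (x ≟ i) ∧ does (y ≟ j)) ∨ (does (x ≟ j) ∧ does (y ≟ i)) then just k else c x y

NonEdge : ∀ {n} → ECGraph n → Fin n → Fin n → Set
NonEdge G i j = i ≢ j × col G i j ≡ nothing

BadIn : ∀ {h n} → Graph h → ECGraph n → ℕ → Fin n → Fin n → Set
BadIn H G k i j = NonEdge G i j × ¬ RainbowCopy H (addEdge (col G) i j k)

Bad : ∀ {h n} → Graph h → ECGraph n → Fin n → Fin n → Set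
Bad H G i j = ∃ λ k → BadIn H G k i j

RainbowSaturated : ∀ {h n} → Graph h → ECGraph n → Set
RainbowSaturated H G =
  ¬ RainbowCopy H (col G) ×
  (∀ i j → NonEdge G i j → ∀ k → RainbowCopy H (addEdge (col G) i j k))

-- G has exactly m bad non-edges: the bad non-edges {i,j} (listed as i < j)
-- are enumerated bijectively by Fin m.
ExactlyBad : ∀ {h n} → Graph h → ECGraph n → ℕ → Set
ExactlyBad {n = n} H G m =
  Σ (Fin m → Fin n × Fin n) λ f →
    (∀ t → proj₁ (f t) <ᶠ proj₂ (f t) × Bad H G (proj₁ (f t)) (proj₂ (f t))) ×
    Injective _≡_ _≡_ f ×
    (∀ i j → i <ᶠ j → Bad H G i j → ∃ λ t → f t ≡ (i , j))

-- rsat(n,H) ≤ k, i.e. min{|E(G)| : G an H-rainbow saturated ECGraph on n vertices} ≤ k,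
-- unfolded: some H-rainbow saturated edge-coloured graph on n vertices has ≤ k edges.
RsatLe : ∀ {h} → ℕ → Graph h → ℕ → Set
RsatLe n H k = Σ (ECGraph n) λ G → RainbowSaturated H G × edgeCount G ≤ k

{-# OPTIONS --safe #-}
-- Saturate G greedily: run through the bad non-edges of G and insert each one,
-- in a colour witnessing its badness, if it is still a non-edge that is bad in
-- the current graph. Every insertion keeps the graph free of rainbow copies of H
-- and adds one edge, so at most m edges are added. Adding edges only creates
-- rainbow copies, so a non-edge that is good at some stage stays good; hence in
-- the final graph every non-edge is good, i.e. the graph is H-rainbow saturated.
-- Constructively, "bad in the current graph" must be decided although there are
-- infinitely many colours; this works because a colour unused by the graph is
-- at least as good as any other, and rainbow copies can be found by a finite search.
module Submission where

open import Defs hiding (sym)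
open import Data.Bool using (Bool; T; T?; _∧_; true)
open import Data.Bool.Properties using (T-∧) renaming (_≟_ to _≟ᵇ_)
open import Data.Empty using (⊥; ⊥-elim)
open import Data.Fin using (Fin; toℕ; _≟_; finToFun; funToFin) renaming (_<_ to _<ᶠ_)
open import Data.Fin.Properties using (any?; all?; <-cmp; <-asym; <⇒≢; finToFun-funToFin)
open import Data.List using (List; []; _∷_; _++_; [_]; length; filter; tabulate)
open import Data.List.Membership.Propositional using (_∈_)
open import Data.List.Membership.Propositional.Properties using (∈-tabulate⁺)
open import Data.List.Properties using (length-++; length-tabulate)
open import Data.List.Relation.Unary.All as All using (All; []; _∷_)
import Data.List.Relation.Unary.All.Properties as All
open import Data.List.Relation.Unary.AllPairs using (_∷_)
open import Data.List.Relation.Unary.Any using (here; there)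
open import Data.List.Relation.Unary.Unique.Propositional using (Unique)
open import Data.List.Relation.Unary.Unique.Propositional.Properties using (cartesianProduct⁺; allFin⁺)
open import Data.Maybe using (Maybe; just; nothing; is-just)
open import Data.Maybe.Properties using (just-injective) renaming (≡-dec to ≡-decᴹ)
open import Data.Nat using (ℕ; suc; _+_; _≤_; _<ᵇ_; z≤n; s≤s)
open import Data.Nat.Properties as ℕ using (m≤m+n; m≤n⇒m≤1+n; +-assoc; +-comm; +-monoˡ-≤; <ᵇ⇒<)
open import Data.Product using (∃; ∃₂; _×_; _,_; proj₁; proj₂; uncurry)
open import Data.Sum using (_⊎_; inj₁; inj₂)
open import Function using (_∘_; _⇔_; mk⇔; Equivalence)
open import Relation.Binary using (tri<; tri≈; tri>)
open import Relation.Binary.PropositionalEquality using (_≡_; _≢_; refl; sym; trans; cong; cong₂; subst; _≗_; module ≡-Reasoning)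
open import Relation.Nullary using (¬_; Dec; yes; no; contradiction)
open import Relation.Nullary.Decidable using (_×-dec_; _⊎-dec_; _→-dec_; ¬?; map′; dec-true; dec-false; decidable-stable)
open import Relation.Unary using (Pred; Decidable)

module _ {a p q} {A : Set a} {P : Pred A p} {Q : Pred A q} (P? : Decidable P) (Q? : Decidable Q) where

  length-filter-mono : ∀ {xs} → (∀ {x} → x ∈ xs → P x → Q x) →
                       length (filter P? xs) ≤ length (filter Q? xs)
  length-filter-mono {[]} _ = z≤n
  length-filter-mono {x ∷ xs} P⇒Q with P? x | Q? x
  ... | yes _  | yes _  = s≤s (length-filter-mono (P⇒Q ∘ there))
  ... | yes px | no ¬qx = contradiction (P⇒Q (here refl) px) ¬qx
  ... | no _   | yes _  = m≤n⇒m≤1+n (length-filter-mono (P⇒Q ∘ there))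
  ... | no _   | no _   = length-filter-mono (P⇒Q ∘ there)

  length-filter-≤-suc : ∀ {a xs} → Unique xs → (∀ {x} → P x → Q x ⊎ x ≡ a) →
                        length (filter P? xs) ≤ suc (length (filter Q? xs))
  length-filter-≤-suc {xs = []} _ _ = z≤n
  length-filter-≤-suc {xs = x ∷ xs} (x∉xs ∷ unique) P⇒Q⊎a with P? x | Q? x
  ... | yes _  | yes _  = s≤s (length-filter-≤-suc unique P⇒Q⊎a)
  ... | no _   | yes _  = m≤n⇒m≤1+n (length-filter-≤-suc unique P⇒Q⊎a)
  ... | no _   | no _   = length-filter-≤-suc unique P⇒Q⊎a
  ... | yes px | no ¬qx = s≤s (length-filter-mono P⇒Q-on-xs)
    where
    P⇒Q-on-xs : ∀ {y} → y ∈ xs → P y → Q y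
    P⇒Q-on-xs y∈xs py with P⇒Q⊎a py | P⇒Q⊎a px
    ... | inj₁ qy   | _         = qy
    ... | inj₂ _    | inj₁ qx   = contradiction qx ¬qx
    ... | inj₂ refl | inj₂ refl = contradiction refl (All.lookup x∉xs y∈xs)

∃-function? : ∀ {m n p} {P : Pred (Fin m → Fin n) p} →
              (∀ {φ ψ} → φ ≗ ψ → P φ → P ψ) → Decidable P → Dec (∃ P)
∃-function? resp P? =
  map′ (λ (t , pt) → finToFun t , pt)
       (λ (φ , pφ) → funToFin φ , resp (sym ∘ finToFun-funToFin φ) pφ)
       (any? (P? ∘ finToFun))

HasColour : Maybe ℕ → Set
HasColour m = ∃ λ k → m ≡ just k

hasColour? : ∀ m → Dec (HasColour m)
hasColour? nothing  = no λ ()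
hasColour? (just k) = yes (k , refl)

∃-just? : ∀ m {p} {P : Pred ℕ p} → Decidable P → Dec (∃ λ k → m ≡ just k × P k)
∃-just? nothing  P? = no λ ()
∃-just? (just k) P? = map′ (λ pk → k , refl , pk) (λ { (_ , refl , pk) → pk }) (P? k)

SharedColour : Maybe ℕ → Maybe ℕ → Set
SharedColour m m′ = ∃ λ k → m ≡ just k × m′ ≡ just k

sharedColour? : ∀ m m′ → Dec (SharedColour m m′)
sharedColour? nothing  _         = no λ ()
sharedColour? (just _) nothing   = no λ ()
sharedColour? (just k) (just k′) =
  map′ (λ { refl → k , refl , refl }) (λ { (_ , refl , refl) → refl }) (k ℕ.≟ k′)

SameEdge : ∀ {A : Set} → A → A → A → A → Set
SameEdge x y x′ y′ = (x ≡ x′ × y ≡ y′) ⊎ (x ≡ y′ × y ≡ x′)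

sameEdge? : ∀ {n} (x y x′ y′ : Fin n) → Dec (SameEdge x y x′ y′)
sameEdge? x y x′ y′ = ((x ≟ x′) ×-dec (y ≟ y′)) ⊎-dec ((x ≟ y′) ×-dec (y ≟ x′))

sameEdge-comm : ∀ {A : Set} {x y x′ y′ : A} → SameEdge x y x′ y′ → SameEdge x y y′ x′
sameEdge-comm (inj₁ p) = inj₂ p
sameEdge-comm (inj₂ p) = inj₁ p

sameEdge-flip : ∀ {A : Set} {x y x′ y′ : A} → SameEdge x y x′ y′ → SameEdge y x x′ y′
sameEdge-flip (inj₁ (p , q)) = inj₂ (q , p)
sameEdge-flip (inj₂ (p , q)) = inj₁ (q , p)

module _ {n : ℕ} where

  _⊆_ : Col n → Col n → Set
  c ⊆ c′ = ∀ x y {k} → c x y ≡ just k → c′ x y ≡ just k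

  record _⊑_ (c c′ : Col n) : Set where
    field
      keeps-edges    : ∀ {x y k} → c x y ≡ just k → HasColour (c′ x y)
      keeps-distinct : ∀ {x y x′ y′ k k′ l} → c x y ≡ just k → c x′ y′ ≡ just k′ →
                       c′ x y ≡ just l → c′ x′ y′ ≡ just l → k ≡ k′

  ⊆⇒⊑ : ∀ {c c′} → c ⊆ c′ → c ⊑ c′
  ⊆⇒⊑ c⊆c′ = record
    { keeps-edges    = λ e → _ , c⊆c′ _ _ e
    ; keeps-distinct = λ e e′ f f′ →
        just-injective (trans (sym (c⊆c′ _ _ e)) (trans f (trans (sym f′) (c⊆c′ _ _ e′))))
    }

  Fresh : Col n → ℕ → Set
  Fresh c k = ∀ x y → c x y ≢ just k

  -- the test in addEdge is definitionally does (sameEdge? x y i j)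
  addEdge-on : ∀ {i j x y : Fin n} c k → SameEdge x y i j → addEdge c i j k x y ≡ just k
  addEdge-on {i} {j} {x} {y} _ _ e rewrite dec-true (sameEdge? x y i j) e = refl

  addEdge-off : ∀ {i j x y : Fin n} c k → ¬ SameEdge x y i j → addEdge c i j k x y ≡ c x y
  addEdge-off {i} {j} {x} {y} _ _ ¬e rewrite dec-false (sameEdge? x y i j) ¬e = refl

  addEdge-comm : ∀ {c i j k} x y → addEdge c i j k x y ≡ addEdge c j i k x y
  addEdge-comm {c} {i} {j} {k} x y with sameEdge? x y i j
  ... | yes e = trans (addEdge-on c k e) (sym (addEdge-on c k (sameEdge-comm e)))
  ... | no ¬e = trans (addEdge-off c k ¬e) (sym (addEdge-off c k (¬e ∘ sameEdge-comm)))

  addEdge-⊆ : ∀ {c c′} i j k → c ⊆ c′ → addEdge c i j k ⊆ addEdge c′ i j k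
  addEdge-⊆ {c} {c′} i j k c⊆c′ x y e with sameEdge? x y i j
  ... | yes s = trans (addEdge-on c′ k s) (trans (sym (addEdge-on c k s)) e)
  ... | no ¬s = trans (addEdge-off c′ k ¬s) (c⊆c′ x y (trans (sym (addEdge-off c k ¬s)) e))

  addEdge-fresh-⊑ : ∀ {c} i j {k k′} → Fresh c k′ → addEdge c i j k ⊑ addEdge c i j k′
  addEdge-fresh-⊑ {c} i j {k} {k′} fresh = record
    { keeps-edges = keeps-edges ; keeps-distinct = keeps-distinct }
    where
    keeps-edges : ∀ {x y l} → addEdge c i j k x y ≡ just l → HasColour (addEdge c i j k′ x y)
    keeps-edges {x} {y} e with sameEdge? x y i j
    ... | yes s = k′ , addEdge-on c k′ s
    ... | no ¬s = _ , trans (addEdge-off c k′ ¬s) (trans (sym (addEdge-off c k ¬s)) e)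

    old≢new : ∀ {x y x′ y′ l} → ¬ SameEdge x y i j → SameEdge x′ y′ i j →
              addEdge c i j k′ x y ≡ just l → addEdge c i j k′ x′ y′ ≡ just l → ⊥
    old≢new ¬s s′ f f′ =
      fresh _ _ (trans (sym (addEdge-off c k′ ¬s)) (trans f (trans (sym f′) (addEdge-on c k′ s′))))

    keeps-distinct : ∀ {x y x′ y′ l l′ l″} →
      addEdge c i j k x y ≡ just l → addEdge c i j k x′ y′ ≡ just l′ →
      addEdge c i j k′ x y ≡ just l″ → addEdge c i j k′ x′ y′ ≡ just l″ → l ≡ l′
    keeps-distinct {x} {y} {x′} {y′} e e′ f f′ with sameEdge? x y i j | sameEdge? x′ y′ i j
    ... | yes s | yes s′ =
      just-injective (trans (sym e) (trans (addEdge-on c k s) (sym (trans (sym e′) (addEdge-on c k s′)))))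
    ... | no ¬s | yes s′ = ⊥-elim (old≢new ¬s s′ f f′)
    ... | yes s | no ¬s′ = ⊥-elim (old≢new ¬s′ s f′ f)
    ... | no ¬s | no ¬s′ = just-injective (begin
      just _                 ≡⟨ sym e ⟩
      addEdge c i j k x y    ≡⟨ addEdge-off c k ¬s ⟩
      c x y                  ≡⟨ sym (addEdge-off c k′ ¬s) ⟩
      addEdge c i j k′ x y   ≡⟨ trans f (sym f′) ⟩
      addEdge c i j k′ x′ y′ ≡⟨ addEdge-off c k′ ¬s′ ⟩
      c x′ y′                ≡⟨ sym (addEdge-off c k ¬s′) ⟩
      addEdge c i j k x′ y′  ≡⟨ e′ ⟩
      just _                 ∎)
      where open ≡-Reasoning

module _ {h n : ℕ} (H : Graph h) where

  rainbowCopy-⊑ : ∀ {c c′ : Col n} → c ⊑ c′ → RainbowCopy H c → RainbowCopy H c′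
  rainbowCopy-⊑ c⊑c′ copy = record
    { φ       = φ
    ; φ-inj   = φ-inj
    ; edges   = λ u v uv → keeps-edges (proj₂ (edges u v uv))
    ; rainbow = λ u v u′ v′ l uv u′v′ f f′ →
        let (k , e) = edges u v uv ; (k′ , e′) = edges u′ v′ u′v′
        in rainbow u v u′ v′ k uv u′v′ e (subst (λ z → _ ≡ just z) (sym (keeps-distinct e e′ f f′)) e′)
    }
    where
    open RainbowCopy copy
    open _⊑_ c⊑c′

  rainbowCopy-⊆ : ∀ {c c′ : Col n} → c ⊆ c′ → RainbowCopy H c → RainbowCopy H c′
  rainbowCopy-⊆ = rainbowCopy-⊑ ∘ ⊆⇒⊑

  module _ (c : Col n) where

    RainbowEmbedding : (Fin h → Fin n) → Set
    RainbowEmbedding φ =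
        (∀ x y → φ x ≡ φ y → x ≡ y)
      × (∀ u v → adj H u v ≡ true → HasColour (c (φ u) (φ v)))
      × (∀ u v u′ v′ → adj H u v ≡ true → adj H u′ v′ ≡ true →
           SharedColour (c (φ u) (φ v)) (c (φ u′) (φ v′)) → SameEdge u v u′ v′)

    rainbowEmbedding? : ∀ φ → Dec (RainbowEmbedding φ)
    rainbowEmbedding? φ =
          all? (λ x → all? λ y → (φ x ≟ φ y) →-dec (x ≟ y))
      ×-dec all? (λ u → all? λ v → (adj H u v ≟ᵇ true) →-dec hasColour? _)
      ×-dec all? (λ u → all? λ v → all? λ u′ → all? λ v′ →
              (adj H u v ≟ᵇ true) →-dec (adj H u′ v′ ≟ᵇ true) →-dec
              sharedColour? _ _ →-dec sameEdge? u v u′ v′)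

    rainbowEmbedding-resp-≗ : ∀ {φ ψ} → φ ≗ ψ → RainbowEmbedding φ → RainbowEmbedding ψ
    rainbowEmbedding-resp-≗ {φ} {ψ} φ≗ψ (inj , edges , rainbow) =
        (λ x y e → inj x y (trans (φ≗ψ x) (trans e (sym (φ≗ψ y)))))
      , (λ u v uv → let (k , e) = edges u v uv in k , trans (sym (same u v)) e)
      , (λ u v u′ v′ uv u′v′ (k , e , e′) →
           rainbow u v u′ v′ uv u′v′ (k , trans (same u v) e , trans (same u′ v′) e′))
      where
      same : ∀ u v → c (φ u) (φ v) ≡ c (ψ u) (ψ v)
      same u v = cong₂ c (φ≗ψ u) (φ≗ψ v)

    rainbowCopy⇔embedding : RainbowCopy H c ⇔ ∃ RainbowEmbedding
    rainbowCopy⇔embedding = mk⇔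
      (λ copy → let open RainbowCopy copy in
         φ , (λ _ _ → φ-inj) , edges ,
         λ u v u′ v′ uv u′v′ (k , e , e′) → rainbow u v u′ v′ k uv u′v′ e e′)
      (λ (φ , inj , edges , rainbow) → record
         { φ = φ ; φ-inj = inj _ _ ; edges = edges
         ; rainbow = λ u v u′ v′ k uv u′v′ e e′ → rainbow u v u′ v′ uv u′v′ (k , e , e′) })

    rainbowCopy? : Dec (RainbowCopy H c)
    rainbowCopy? = map′ (Equivalence.from rainbowCopy⇔embedding) (Equivalence.to rainbowCopy⇔embedding)
      (∃-function? rainbowEmbedding-resp-≗ rainbowEmbedding?)

  Good : Col n → Fin n → Fin n → Set
  Good c i j = ∀ k → RainbowCopy H (addEdge c i j k)

  good-⊆ : ∀ {c c′ i j} → c ⊆ c′ → Good c i j → Good c′ i j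
  good-⊆ {i = i} {j} c⊆c′ good k = rainbowCopy-⊆ (addEdge-⊆ i j k c⊆c′) (good k)

  good-comm : ∀ {c i j} → Good c i j → Good c j i
  good-comm {c} good k = rainbowCopy-⊆ (λ x y e → trans (sym (addEdge-comm {c = c} x y)) e) (good k)

  module _ (c : Col n) (i j : Fin n) where

    usedBadColour? : Dec (∃₂ λ x y → ∃ λ k → c x y ≡ just k × ¬ RainbowCopy H (addEdge c i j k))
    usedBadColour? =
      any? λ x → any? λ y → ∃-just? (c x y) λ k → ¬? (rainbowCopy? (addEdge c i j k))

    good⊎badColour : Good c i j ⊎ ∃ λ k → ¬ RainbowCopy H (addEdge c i j k)
    good⊎badColour with usedBadColour? | rainbowCopy? (addEdge c i j 0)
    ... | yes (_ , _ , k , _ , bad) | _        = inj₂ (k , bad)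
    ... | no _                      | no bad   = inj₂ (_ , bad)
    ... | no noneBad                | yes copy = inj₁ good
      where
      -- a colour unused by c is at least as good as any other colour, e.g. 0
      good : Good c i j
      good k with any? (λ x → any? λ y → ≡-decᴹ ℕ._≟_ (c x y) (just k))
      ... | yes (x , y , e) = decidable-stable (rainbowCopy? _) λ bad → noneBad (x , y , k , e , bad)
      ... | no unused = rainbowCopy-⊑ (addEdge-fresh-⊑ i j λ x y e → unused (x , y , e)) copy

module _ {n : ℕ} where

  nonEdge-⊆ : ∀ {c c′ : Col n} {x y} → c ⊆ c′ → c′ x y ≡ nothing → c x y ≡ nothing
  nonEdge-⊆ {c} {x = x} {y} c⊆c′ xy∉c′ with c x y in xy∈c
  ... | nothing = refl
  ... | just _  = contradiction (trans (sym xy∉c′) (c⊆c′ x y xy∈c)) λ ()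

  addColouredEdge : (G : ECGraph n) {i j : Fin n} → i ≢ j → ℕ → ECGraph n
  addColouredEdge G {i} {j} i≢j k = record
    { col = addEdge (col G) i j k ; sym = symmetric ; irrefl = irreflexive }
    where
    symmetric : ∀ x y → addEdge (col G) i j k x y ≡ addEdge (col G) i j k y x
    symmetric x y with sameEdge? x y i j
    ... | yes s = trans (addEdge-on (col G) k s) (sym (addEdge-on (col G) k (sameEdge-flip s)))
    ... | no ¬s = trans (addEdge-off (col G) k ¬s)
                    (trans (ECGraph.sym G x y) (sym (addEdge-off (col G) k (¬s ∘ sameEdge-flip))))
    irreflexive : ∀ x → addEdge (col G) i j k x x ≡ nothing
    irreflexive x with sameEdge? x x i j
    ... | yes (inj₁ (refl , refl)) = contradiction refl i≢j
    ... | yes (inj₂ (refl , refl)) = contradiction refl i≢j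
    ... | no ¬s = trans (addEdge-off (col G) k ¬s) (ECGraph.irrefl G x)

  col⊆addEdge : ∀ (G : ECGraph n) {i j} k → col G i j ≡ nothing → col G ⊆ addEdge (col G) i j k
  col⊆addEdge G {i} {j} k ij∉G x y xy∈G with sameEdge? x y i j
  ... | yes (inj₁ (refl , refl)) = contradiction (trans (sym ij∉G) xy∈G) λ ()
  ... | yes (inj₂ (refl , refl)) = contradiction (trans (sym ij∉G) (trans (ECGraph.sym G i j) xy∈G)) λ ()
  ... | no ¬s = trans (addEdge-off (col G) k ¬s) xy∈G

  -- definitionally the filter predicate of edgeCount
  counted : Col n → Fin n × Fin n → Bool
  counted c p = (toℕ (proj₁ p) <ᵇ toℕ (proj₂ p)) ∧ is-just (c (proj₁ p) (proj₂ p))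

  edgeCount-addColouredEdge : ∀ (G : ECGraph n) {i j} (i<j : i <ᶠ j) k →
                              edgeCount (addColouredEdge G (<⇒≢ i<j) k) ≤ suc (edgeCount G)
  edgeCount-addColouredEdge G {i} {j} i<j k =
    length-filter-≤-suc (T? ∘ counted (addEdge (col G) i j k)) (T? ∘ counted (col G))
      (cartesianProduct⁺ (allFin⁺ n) (allFin⁺ n)) old⊎ij
    where
    old⊎ij : ∀ {p} → T (counted (addEdge (col G) i j k) p) → T (counted (col G) p) ⊎ p ≡ (i , j)
    old⊎ij {x , y} t with sameEdge? x y i j
    ... | yes (inj₁ (refl , refl)) = inj₂ refl
    ... | yes (inj₂ (refl , refl)) = contradiction (<ᵇ⇒< _ _ (proj₁ (Equivalence.to T-∧ t))) (<-asym i<j)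
    ... | no ¬s = inj₁ (subst (λ m → T ((toℕ x <ᵇ toℕ y) ∧ is-just m)) (addEdge-off (col G) k ¬s) t)

module _ {h n : ℕ} (H : Graph h) where

  Settled : Col n → Fin n → Fin n → Set
  Settled c i j = HasColour (c i j) ⊎ Good H c i j

  settled-⊆ : ∀ {c c′ i j} → c ⊆ c′ → Settled c i j → Settled c′ i j
  settled-⊆ c⊆c′ (inj₁ (k , ij∈c)) = inj₁ (k , c⊆c′ _ _ ij∈c)
  settled-⊆ c⊆c′ (inj₂ good)       = inj₂ (good-⊆ H c⊆c′ good)

  record SettlingExtension (G : ECGraph n) (L : List (Fin n × Fin n)) : Set where
    field
      graph       : ECGraph n
      extends     : col G ⊆ col graph
      rainbowFree : ¬ RainbowCopy H (col graph)
      edgeCount≤  : edgeCount graph ≤ edgeCount G + length L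
      settled     : All (uncurry (Settled (col graph))) L

  open SettlingExtension

  unchanged : ∀ {G L} → ¬ RainbowCopy H (col G) → All (uncurry (Settled (col G))) L →
              SettlingExtension G L
  unchanged {G} free settled = record
    { graph = G ; extends = λ _ _ e → e ; rainbowFree = free
    ; edgeCount≤ = m≤m+n _ _ ; settled = settled }

  _⨾_ : ∀ {G L L′} (s : SettlingExtension G L) → SettlingExtension (graph s) L′ →
        SettlingExtension G (L ++ L′)
  _⨾_ {G} {L} {L′} s s′ = record
    { graph       = graph s′
    ; extends     = λ x y e → extends s′ x y (extends s x y e)
    ; rainbowFree = rainbowFree s′
    ; edgeCount≤  = begin
        edgeCount (graph s′)                       ≤⟨ edgeCount≤ s′ ⟩
        edgeCount (graph s) + length L′            ≤⟨ +-monoˡ-≤ (length L′) (edgeCount≤ s) ⟩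
        edgeCount G + length L + length L′         ≡⟨ +-assoc (edgeCount G) (length L) (length L′) ⟩
        edgeCount G + (length L + length L′)       ≡⟨ cong (edgeCount G +_) (sym (length-++ L)) ⟩
        edgeCount G + length (L ++ L′)             ∎
    ; settled     = All.++⁺ (All.map (settled-⊆ (extends s′)) (settled s)) (settled s′)
    }
    where open ℕ.≤-Reasoning

  settle : ∀ G → ¬ RainbowCopy H (col G) → ∀ {i j} → i <ᶠ j → SettlingExtension G [ (i , j) ]
  settle G free {i} {j} i<j with col G i j in ij∈G | good⊎badColour H (col G) i j
  ... | just k  | _              = unchanged free (inj₁ (k , ij∈G) ∷ [])
  ... | nothing | inj₁ good      = unchanged free (inj₂ good ∷ [])
  ... | nothing | inj₂ (k , bad) = record
    { graph       = addColouredEdge G (<⇒≢ i<j) k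
    ; extends     = col⊆addEdge G k ij∈G
    ; rainbowFree = bad
    ; edgeCount≤  = subst (edgeCount (addColouredEdge G (<⇒≢ i<j) k) ≤_) (+-comm 1 (edgeCount G))
                          (edgeCount-addColouredEdge G i<j k)
    ; settled     = inj₁ (k , addEdge-on (col G) k (inj₁ (refl , refl))) ∷ []
    }

  settleAll : ∀ G → ¬ RainbowCopy H (col G) → ∀ L → All (uncurry _<ᶠ_) L → SettlingExtension G L
  settleAll G free []      []            = unchanged free []
  settleAll G free (_ ∷ L) (i<j ∷ i<js) = s ⨾ settleAll (graph s) (rainbowFree s) L i<js
    where s = settle G free i<j

  good-if-bad⇒settled : ∀ (G G′ : ECGraph n) {i j} → col G ⊆ col G′ →
                        (Bad H G i j → Settled (col G′) i j) → NonEdge G′ i j → Good H (col G′) i j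
  good-if-bad⇒settled G G′ {i} {j} G⊆G′ bad⇒settled (i≢j , ij∉G′) k
    with rainbowCopy? H (addEdge (col G) i j k)
  ... | yes copy = rainbowCopy-⊆ H (addEdge-⊆ i j k G⊆G′) copy
  ... | no bad with bad⇒settled (k , (i≢j , nonEdge-⊆ G⊆G′ ij∉G′) , bad)
  ...   | inj₁ (_ , ij∈G′) = contradiction (trans (sym ij∉G′) ij∈G′) λ ()
  ...   | inj₂ good        = good k

  saturated : ∀ (G G′ : ECGraph n) → col G ⊆ col G′ →
              (∀ {i j} → i <ᶠ j → Bad H G i j → Settled (col G′) i j) →
              ∀ i j → NonEdge G′ i j → Good H (col G′) i j
  saturated G G′ G⊆G′ bad⇒settled i j (i≢j , ij∉G′) with <-cmp i j
  ... | tri< i<j _ _ = good-if-bad⇒settled G G′ G⊆G′ (bad⇒settled i<j) (i≢j , ij∉G′)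
  ... | tri≈ _ i≡j _ = contradiction i≡j i≢j
  ... | tri> _ _ j<i = good-comm H (good-if-bad⇒settled G G′ G⊆G′ (bad⇒settled j<i)
                         (i≢j ∘ sym , trans (ECGraph.sym G′ j i) ij∉G′))

proposition4 : ∀ {h n : ℕ} (H : Graph h) (G : ECGraph n) (m : ℕ) →
    ¬ RainbowCopy H (col G) → ExactlyBad H G m → RsatLe n H (edgeCount G + m)
proposition4 H G m free (f , f-ordered-bad , _ , f-covers) =
  graph , (rainbowFree , saturated H G graph extends bad⇒settled) ,
  subst (λ l → edgeCount graph ≤ edgeCount G + l) (length-tabulate f) edgeCount≤
  where
  open SettlingExtension (settleAll H G free (tabulate f) (All.tabulate⁺ (proj₁ ∘ f-ordered-bad)))
  bad⇒settled : ∀ {i j} → i <ᶠ j → Bad H G i j → Settled H (col graph) i j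
  bad⇒settled i<j bad with f-covers _ _ i<j bad
  ... | t , refl = All.lookup settled (∈-tabulate⁺ t)
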